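{- Let $k$ be a positive integer and let $G$ be a finite simple bipartite graph with $\kappa(G)=k$ and $\delta(G)\geq k+1$. Then for every end $F$ of $G$ to a minimum separating set $S$, and for every minimum separating set $S_{1}$ of $G$, we have $V(F)\cap S_{1}=\emptyset$.
   Context: $\kappa(G)$ denotes the (vertex) connectivity and $\delta(G)$ the minimum degree of $G$. A separating set of $G$ is a set of vertices whose removal disconnects $G$; it is minimum if it has cardinality $\kappa(G)$. If $S$ is a minimum separating set of $G$, a fragment $F$ of $G$ to $S$ is a union of at least one component of $G-S$ such that $G-S-F\neq\emptyset$ (so $N_G(F)=S$); the complementary fragment is $\bar F=G-(S\cup V(F))$. A fragment of $G$ (to some minimum separating set) that does not contain any other fragment of $G$ (to any minimum separating set) is called an end of $G$. -}

module Defs where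

open import Data.Nat using (ℕ; _≤_; _+_)
open import Data.Bool using (Bool; true; false)
open import Data.Fin using (Fin)
open import Data.Fin.Subset using (Subset; _∈_; _∉_; _⊆_; ∁; ∣_∣)
open import Data.Vec using (tabulate)
open import Data.Product using (Σ; ∃; _×_; _,_)
open import Data.Sum using (_⊎_)
open import Relation.Nullary using (¬_)
open import Relation.Binary.PropositionalEquality using (_≡_; _≢_)

record Graph (n : ℕ) : Set where
  field
    adj   : Fin n → Fin n → Bool
    sym   : ∀ u v → adj u v ≡ adj v u
    irrefl : ∀ v → adj v v ≡ false
open Graph public

module _ {n : ℕ} (G : Graph n) where

  Bipartite : Set
  Bipartite = Σ (Fin n → Bool) λ c → ∀ u v → adj G u v ≡ true → c u ≢ c v

  deg : Fin n → ℕ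
  deg v = ∣ tabulate (λ u → adj G v u) ∣

  MinDegree≥ : ℕ → Set
  MinDegree≥ d = ∀ v → d ≤ deg v

  data Walk (X : Subset n) : Fin n → Fin n → Set where
    here : ∀ {u} → u ∈ X → Walk X u u
    step : ∀ {u w v} → u ∈ X → adj G u w ≡ true → Walk X w v → Walk X u v

  Disconnected : Subset n → Set
  Disconnected X = ∃ λ u → ∃ λ v → u ∈ X × v ∈ X × ¬ Walk X u v

  Separating : Subset n → Set
  Separating S = Disconnected (∁ S)

  AtMostOneLeft : Subset n → Set
  AtMostOneLeft S = ∀ u v → u ∈ ∁ S → v ∈ ∁ S → u ≡ v

  -- κ(G) = k (standard definition: least |S| with G - S disconnected or trivial)
  Connectivity : ℕ → Set
  Connectivity k =
    (∃ λ S → ∣ S ∣ ≡ k × (Separating S ⊎ AtMostOneLeft S)) ×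
    (∀ S → (Separating S ⊎ AtMostOneLeft S) → k ≤ ∣ S ∣)

  MinSep : ℕ → Subset n → Set
  MinSep k S = Separating S × ∣ S ∣ ≡ k

  -- F is a fragment to S: a union of at least one component of G - S
  -- (nonempty, contained in G - S, closed under walks in G - S),
  -- such that G - S - F is nonempty.
  Fragment : Subset n → Subset n → Set
  Fragment S F =
    (∃ λ v → v ∈ F) ×
    F ⊆ ∁ S ×
    (∀ u v → u ∈ F → Walk (∁ S) u v → v ∈ F) ×
    (∃ λ v → v ∈ ∁ S × v ∉ F)

  -- F is an end of G to the minimum separating set S (κ(G) = k):
  -- F is a fragment to S, and no fragment F' to any minimum separating set S'
  -- is a proper subset of F.
  EndTo : ℕ → Subset n → Subset n → Set
  EndTo k S F =
    MinSep k S × Fragment S F ×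
    (∀ S' F' → MinSep k S' → Fragment S' F' → F' ⊆ F → F ⊆ F')

-- Let S₁ be a minimum separating set meeting the end F, with sides A and B = V − S₁ − A, and let
-- F̄ = V − S − F.  If F meets a side Q of S₁ while F̄ meets the opposite side, the "corner" F ∩ Q is
-- a fragment to (S ∩ Q) ∪ (S ∩ S₁) ∪ (F ∩ S₁); this corner separator and its diagonal partner
-- have total size at most ∣S∣ + ∣S₁∣ = 2k, so both are minimum, and minimality of the end forces
-- F ⊆ Q, contradicting F ∩ S₁ ≠ ∅.  Hence in each of the four cases for which of F ∩ A, F ∩ B is
-- nonempty, one of F, F̄, A, B is a fragment contained in S or S₁.  That is impossible in a
-- bipartite graph of minimum degree k + 1: a vertex x of a fragment X to Y either has all its
-- neighbours in Y, or has a neighbour y ∈ X, and then N(x), N(y) are disjoint subsets of X ∪ Y,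
-- so 2(k + 1) ≤ ∣X∣ + ∣Y∣.
module Submission where

open import Defs hiding (sym)
open import Data.Bool using (true)
open import Data.Bool.Properties using (¬-not)
open import Data.Empty using (⊥; ⊥-elim)
open import Data.Fin using (Fin; zero; suc)
open import Data.Fin.Subset
  using (Subset; _∈_; _∉_; _⊆_; ∁; ∣_∣; _∩_; _∪_; Nonempty; Empty; inside; outside)
open import Data.Fin.Subset.Properties
  using (_∈?_; nonempty?; ∩-comm; p∩q⊆p; p⊆q⇒∣p∣≤∣q∣; x∈p∩q⁺; x∈p∩q⁻; x∈p∪q⁺; x∈p∪q⁻;
         x∈∁p⇒x∉p; x∉p⇒x∈∁p; x∉∁p⇒x∈p)
open import Data.Nat using (ℕ; zero; suc; _+_; _≤_; _<_; s≤s; z≤n)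
open import Data.Nat.Properties
  using (+-suc; +-mono-≤; +-mono-<; +-cancelʳ-≤; ≤-trans; ≤-antisym; ≤-refl; ≤-<-trans; <⇒≱; m<m+n)
open import Data.Product using (∃; _×_; _,_; proj₁; proj₂)
open import Data.Sum using (_⊎_; inj₁; inj₂; [_,_]′)
open import Data.Vec using ([]; _∷_; tabulate)
open import Data.Vec.Properties using (lookup∘tabulate; []=⇒lookup; lookup⇒[]=)
open import Relation.Nullary using (¬_; Dec; yes; no; does)
open import Relation.Nullary.Decidable using (dec-true)
open import Relation.Nullary.Decidable.Core using (¬¬-excluded-middle)
open import Function using (_∘_)
open import Relation.Binary.PropositionalEquality using (_≡_; refl; sym; trans; cong; cong₂; subst)

private
  variable
    n : ℕ
    x : Fin n
    p q S S₁ P Q A F X Y Z : Subset n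

+-sucʳ-cong : ∀ {a b c d} → a + b ≡ c + d → a + suc b ≡ c + suc d
+-sucʳ-cong {a} {b} {c} {d} e = trans (+-suc a b) (trans (cong suc e) (sym (+-suc c d)))

∣p∩q∣+∣p∪q∣≡∣p∣+∣q∣ : (p q : Subset n) → ∣ p ∩ q ∣ + ∣ p ∪ q ∣ ≡ ∣ p ∣ + ∣ q ∣
∣p∩q∣+∣p∪q∣≡∣p∣+∣q∣ []            []            = refl
∣p∩q∣+∣p∪q∣≡∣p∣+∣q∣ (inside  ∷ p) (inside  ∷ q) = cong suc (+-sucʳ-cong (∣p∩q∣+∣p∪q∣≡∣p∣+∣q∣ p q))
∣p∩q∣+∣p∪q∣≡∣p∣+∣q∣ (inside  ∷ p) (outside ∷ q) = trans (+-suc _ _) (cong suc (∣p∩q∣+∣p∪q∣≡∣p∣+∣q∣ p q))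
∣p∩q∣+∣p∪q∣≡∣p∣+∣q∣ (outside ∷ p) (inside  ∷ q) = +-sucʳ-cong (∣p∩q∣+∣p∪q∣≡∣p∣+∣q∣ p q)
∣p∩q∣+∣p∪q∣≡∣p∣+∣q∣ (outside ∷ p) (outside ∷ q) = ∣p∩q∣+∣p∪q∣≡∣p∣+∣q∣ p q

∩⊆∩∧∪⊆∪⇒∣p∣+∣q∣≤∣r∣+∣s∣ : (p q r s : Subset n) →
  p ∩ q ⊆ r ∩ s → p ∪ q ⊆ r ∪ s → ∣ p ∣ + ∣ q ∣ ≤ ∣ r ∣ + ∣ s ∣
∩⊆∩∧∪⊆∪⇒∣p∣+∣q∣≤∣r∣+∣s∣ p q r s ∩⊆∩ ∪⊆∪ = begin
  ∣ p ∣ + ∣ q ∣          ≡⟨ sym (∣p∩q∣+∣p∪q∣≡∣p∣+∣q∣ p q) ⟩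
  ∣ p ∩ q ∣ + ∣ p ∪ q ∣  ≤⟨ +-mono-≤ (p⊆q⇒∣p∣≤∣q∣ ∩⊆∩) (p⊆q⇒∣p∣≤∣q∣ ∪⊆∪) ⟩
  ∣ r ∩ s ∣ + ∣ r ∪ s ∣  ≡⟨ ∣p∩q∣+∣p∪q∣≡∣p∣+∣q∣ r s ⟩
  ∣ r ∣ + ∣ s ∣          ∎
  where open Data.Nat.Properties.≤-Reasoning

Empty-∩-comm : Empty (p ∩ q) → Empty (q ∩ p)
Empty-∩-comm {p = p} {q} = subst Empty (∩-comm p q)

x∈tabulate⁺ : ∀ {f : Fin n → _} → f x ≡ true → x ∈ tabulate f
x∈tabulate⁺ {x = x} {f} fx = lookup⇒[]= x (tabulate f) (trans (lookup∘tabulate f x) fx)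

x∈tabulate⁻ : ∀ {f : Fin n → _} → x ∈ tabulate f → f x ≡ true
x∈tabulate⁻ {x = x} {f} x∈ = trans (sym (lookup∘tabulate f x)) ([]=⇒lookup x∈)

¬¬-decide-Fin : (P : Fin n → Set) → ¬ ¬ (∀ i → Dec (P i))
¬¬-decide-Fin {zero}  P k = k λ ()
¬¬-decide-Fin {suc n} P k =
  ¬¬-excluded-middle λ P₀? → ¬¬-decide-Fin (λ i → P (suc i)) λ P₊? →
  k λ { zero → P₀? ; (suc i) → P₊? i }

opposite : Subset n → Subset n → Subset n
opposite S X = ∁ (S ∪ X)

x∈opposite⁺ : x ∉ S → x ∉ X → x ∈ opposite S X
x∈opposite⁺ x∉S x∉X = x∉p⇒x∈∁p λ x∈S∪X → [ x∉S , x∉X ]′ (x∈p∪q⁻ _ _ x∈S∪X)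

x∈opposite⁻ : x ∈ opposite S X → x ∉ S × x ∉ X
x∈opposite⁻ x∈ = (λ x∈S → x∈∁p⇒x∉p x∈ (x∈p∪q⁺ (inj₁ x∈S))) , (λ x∈X → x∈∁p⇒x∉p x∈ (x∈p∪q⁺ (inj₂ x∈X)))

⊆opposite-opposite : X ⊆ ∁ S → X ⊆ opposite S (opposite S X)
⊆opposite-opposite X⊆∁S x∈X = x∈opposite⁺ (x∈∁p⇒x∉p (X⊆∁S x∈X)) (λ x∈ → proj₂ (x∈opposite⁻ x∈) x∈X)

∩-sides-empty⇒⊆ : Empty (X ∩ Q) → Empty (X ∩ opposite S Q) → X ⊆ S
∩-sides-empty⇒⊆ {Q = Q} {S = S} X∩Q-empty X∩Q̄-empty {x} x∈X with x ∈? S | x ∈? Q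
... | yes x∈S | _       = x∈S
... | no _    | yes x∈Q = ⊥-elim (X∩Q-empty (x , x∈p∩q⁺ (x∈X , x∈Q)))
... | no x∉S  | no x∉Q  = ⊥-elim (X∩Q̄-empty (x , x∈p∩q⁺ (x∈X , x∈opposite⁺ x∉S x∉Q)))

-- The separator of the corner P ∩ Q of two separations (S; P, opposite S P) and (S₁; Q, opposite S₁ Q).
corner : Subset n → Subset n → Subset n → Subset n → Subset n
corner S S₁ P Q = S ∩ Q ∪ S ∩ S₁ ∪ P ∩ S₁

x∈corner⁺ : x ∈ S × x ∈ Q ⊎ x ∈ S × x ∈ S₁ ⊎ x ∈ P × x ∈ S₁ → x ∈ corner S S₁ P Q
x∈corner⁺ (inj₁ x∈S∩Q)          = x∈p∪q⁺ (inj₁ (x∈p∩q⁺ x∈S∩Q))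
x∈corner⁺ (inj₂ (inj₁ x∈S∩S₁)) = x∈p∪q⁺ (inj₂ (x∈p∪q⁺ (inj₁ (x∈p∩q⁺ x∈S∩S₁))))
x∈corner⁺ (inj₂ (inj₂ x∈P∩S₁)) = x∈p∪q⁺ (inj₂ (x∈p∪q⁺ (inj₂ (x∈p∩q⁺ x∈P∩S₁))))

x∈corner⁻ : x ∈ corner S S₁ P Q → x ∈ S × x ∈ Q ⊎ x ∈ S × x ∈ S₁ ⊎ x ∈ P × x ∈ S₁
x∈corner⁻ x∈ with x∈p∪q⁻ _ _ x∈
... | inj₁ x∈S∩Q = inj₁ (x∈p∩q⁻ _ _ x∈S∩Q)
... | inj₂ x∈rest with x∈p∪q⁻ _ _ x∈rest
...   | inj₁ x∈S∩S₁ = inj₂ (inj₁ (x∈p∩q⁻ _ _ x∈S∩S₁))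
...   | inj₂ x∈P∩S₁ = inj₂ (inj₂ (x∈p∩q⁻ _ _ x∈P∩S₁))

corner⊆S∪S₁ : corner S S₁ P Q ⊆ S ∪ S₁
corner⊆S∪S₁ x∈ with x∈corner⁻ x∈
... | inj₁ (x∈S , _)         = x∈p∪q⁺ (inj₁ x∈S)
... | inj₂ (inj₁ (x∈S , _))  = x∈p∪q⁺ (inj₁ x∈S)
... | inj₂ (inj₂ (_ , x∈S₁)) = x∈p∪q⁺ (inj₂ x∈S₁)

x∈corner∧x∉S⇒x∈P : x ∈ corner S S₁ P Q → x ∉ S → x ∈ P
x∈corner∧x∉S⇒x∈P x∈ x∉S with x∈corner⁻ x∈
... | inj₁ (x∈S , _)         = ⊥-elim (x∉S x∈S)
... | inj₂ (inj₁ (x∈S , _))  = ⊥-elim (x∉S x∈S)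
... | inj₂ (inj₂ (x∈P , _))  = x∈P

x∈corner∧x∉S₁⇒x∈Q : x ∈ corner S S₁ P Q → x ∉ S₁ → x ∈ Q
x∈corner∧x∉S₁⇒x∈Q x∈ x∉S₁ with x∈corner⁻ x∈
... | inj₁ (_ , x∈Q)         = x∈Q
... | inj₂ (inj₁ (_ , x∈S₁)) = ⊥-elim (x∉S₁ x∈S₁)
... | inj₂ (inj₂ (_ , x∈S₁)) = ⊥-elim (x∉S₁ x∈S₁)

corner∩opposite-corner⊆S∩S₁ :
  corner S S₁ P Q ∩ corner S S₁ (opposite S P) (opposite S₁ Q) ⊆ S ∩ S₁
corner∩opposite-corner⊆S∩S₁ {S = S} {S₁} {x = x} x∈ with x∈p∩q⁻ _ _ x∈ | x ∈? S | x ∈? S₁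
... | _ | yes x∈S | yes x∈S₁ = x∈p∩q⁺ (x∈S , x∈S₁)
... | x∈T , x∈T̄ | _ | no x∉S₁ =
  ⊥-elim (proj₂ (x∈opposite⁻ (x∈corner∧x∉S₁⇒x∈Q x∈T̄ x∉S₁)) (x∈corner∧x∉S₁⇒x∈Q x∈T x∉S₁))
... | x∈T , x∈T̄ | no x∉S | _ =
  ⊥-elim (proj₂ (x∈opposite⁻ (x∈corner∧x∉S⇒x∈P x∈T̄ x∉S)) (x∈corner∧x∉S⇒x∈P x∈T x∉S))

P∩Q⊆∁corner : P ⊆ ∁ S → Q ⊆ ∁ S₁ → P ∩ Q ⊆ ∁ (corner S S₁ P Q)
P∩Q⊆∁corner P⊆∁S Q⊆∁S₁ x∈P∩Q = x∉p⇒x∈∁p λ x∈T →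
  [ x∈∁p⇒x∉p (P⊆∁S (proj₁ (x∈p∩q⁻ _ _ x∈P∩Q))) , x∈∁p⇒x∉p (Q⊆∁S₁ (proj₂ (x∈p∩q⁻ _ _ x∈P∩Q))) ]′
    (x∈p∪q⁻ _ _ (corner⊆S∪S₁ x∈T))

opposite⊆opposite-corner : opposite S P ⊆ opposite (corner S S₁ P Q) (P ∩ Q)
opposite⊆opposite-corner x∈ = x∈opposite⁺
  (λ x∈T → x∉P (x∈corner∧x∉S⇒x∈P x∈T x∉S))
  (λ x∈P∩Q → x∉P (proj₁ (x∈p∩q⁻ _ _ x∈P∩Q)))
  where
  x∉S = proj₁ (x∈opposite⁻ x∈)
  x∉P = proj₂ (x∈opposite⁻ x∈)

∣corner∣+∣opposite-corner∣≤∣S∣+∣S₁∣ : (S S₁ P Q : Subset n) →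
  ∣ corner S S₁ P Q ∣ + ∣ corner S S₁ (opposite S P) (opposite S₁ Q) ∣ ≤ ∣ S ∣ + ∣ S₁ ∣
∣corner∣+∣opposite-corner∣≤∣S∣+∣S₁∣ S S₁ P Q = ∩⊆∩∧∪⊆∪⇒∣p∣+∣q∣≤∣r∣+∣s∣
  (corner S S₁ P Q) (corner S S₁ (opposite S P) (opposite S₁ Q)) S S₁
  corner∩opposite-corner⊆S∩S₁
  (λ x∈ → [ corner⊆S∪S₁ , corner⊆S∪S₁ ]′ (x∈p∪q⁻ _ _ x∈))

module _ (G : Graph n) where

  infix 4 _∼_
  _∼_ : Fin n → Fin n → Set
  u ∼ v = adj G u v ≡ true

  ∼-sym : ∀ {u v} → u ∼ v → v ∼ u
  ∼-sym {u} {v} = trans (Graph.sym G v u)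

  N : Fin n → Subset n
  N v = tabulate (adj G v)

  Closed : Subset n → Subset n → Set
  Closed S X = ∀ {u w} → u ∈ X → u ∼ w → w ∉ S → w ∈ X

  closed⇒N⊆∪ : Closed Y X → ∀ {u} → u ∈ X → N u ⊆ X ∪ Y
  closed⇒N⊆∪ {Y = Y} X-closed u∈X {w} w∈Nu with w ∈? Y
  ... | yes w∈Y = x∈p∪q⁺ (inj₂ w∈Y)
  ... | no  w∉Y = x∈p∪q⁺ (inj₁ (X-closed u∈X (x∈tabulate⁻ w∈Nu) w∉Y))

  bipartite⇒N∩N-empty : Bipartite G → ∀ {u v} → u ∼ v → Empty (N u ∩ N v)
  bipartite⇒N∩N-empty (_ , proper) {u} {v} u∼v (w , w∈) =
    proper u v u∼v (trans (¬-not (proper u w (x∈tabulate⁻ w∈Nu)))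
                          (sym (¬-not (proper v w (x∈tabulate⁻ w∈Nv)))))
    where
    w∈Nu = proj₁ (x∈p∩q⁻ _ _ w∈)
    w∈Nv = proj₂ (x∈p∩q⁻ _ _ w∈)

  closed⇒d+d≤∣X∣+∣Y∣ : ∀ {d} → Bipartite G → MinDegree≥ G d →
    Closed Y X → Nonempty X → ∣ Y ∣ < d → d + d ≤ ∣ X ∣ + ∣ Y ∣
  closed⇒d+d≤∣X∣+∣Y∣ {Y = Y} {X} bip δ≥d X-closed (x , x∈X) ∣Y∣<d with nonempty? (N x ∩ ∁ Y)
  ... | no Nx∩∁Y-empty = ⊥-elim (<⇒≱ ∣Y∣<d (≤-trans (δ≥d x) (p⊆q⇒∣p∣≤∣q∣ Nx⊆Y)))
    where
    Nx⊆Y : N x ⊆ Y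
    Nx⊆Y w∈Nx = x∉∁p⇒x∈p λ w∈∁Y → Nx∩∁Y-empty (_ , x∈p∩q⁺ (w∈Nx , w∈∁Y))
  ... | yes (y , y∈) = ≤-trans (+-mono-≤ (δ≥d x) (δ≥d y))
    (∩⊆∩∧∪⊆∪⇒∣p∣+∣q∣≤∣r∣+∣s∣ (N x) (N y) X Y
      (λ w∈ → ⊥-elim (bipartite⇒N∩N-empty bip x∼y (_ , w∈)))
      (λ w∈ → [ closed⇒N⊆∪ X-closed x∈X , closed⇒N⊆∪ X-closed y∈X ]′ (x∈p∪q⁻ _ _ w∈)))
    where
    x∼y = x∈tabulate⁻ (proj₁ (x∈p∩q⁻ _ _ y∈))
    y∈X = X-closed x∈X x∼y (x∈∁p⇒x∉p (proj₂ (x∈p∩q⁻ _ _ y∈)))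

  walk-start : ∀ {u v} → Walk G Z u v → u ∈ Z
  walk-start (here u∈Z)     = u∈Z
  walk-start (step u∈Z _ _) = u∈Z

  walk-end : ∀ {u v} → Walk G Z u v → v ∈ Z
  walk-end (here v∈Z)   = v∈Z
  walk-end (step _ _ w) = walk-end w

  walk-snoc : ∀ {u v w} → Walk G Z u v → v ∼ w → w ∈ Z → Walk G Z u w
  walk-snoc (here v∈Z)        v∼w w∈Z = step v∈Z v∼w (here w∈Z)
  walk-snoc (step u∈Z u∼u′ w) v∼w w∈Z = step u∈Z u∼u′ (walk-snoc w v∼w w∈Z)

  walk-closed : Closed S X → ∀ {u v} → Walk G (∁ S) u v → u ∈ X → v ∈ X
  walk-closed X-closed (here _)       u∈X = u∈X
  walk-closed X-closed (step _ u∼w w) u∈X =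
    walk-closed X-closed w (X-closed u∈X u∼w (x∈∁p⇒x∉p (walk-start w)))

  fragment⇒closed : Fragment G S X → Closed S X
  fragment⇒closed (_ , X⊆∁S , X-walk-closed , _) u∈X u∼w w∉S =
    X-walk-closed _ _ u∈X (step (X⊆∁S u∈X) u∼w (here (x∉p⇒x∈∁p w∉S)))

  fragment⇒opposite-nonempty : Fragment G S X → Nonempty (opposite S X)
  fragment⇒opposite-nonempty (_ , _ , _ , (v , v∈∁S , v∉X)) = v , x∈opposite⁺ (x∈∁p⇒x∉p v∈∁S) v∉X

  fragment⇒separating : Fragment G S X → Separating G S
  fragment⇒separating ((u , u∈X) , X⊆∁S , X-walk-closed , (v , v∈∁S , v∉X)) =
    u , v , X⊆∁S u∈X , v∈∁S , λ u⇝v → v∉X (X-walk-closed u v u∈X u⇝v)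

  closed⇒fragment : Nonempty X → Nonempty (opposite S X) → X ⊆ ∁ S → Closed S X → Fragment G S X
  closed⇒fragment X-nonempty (v , v∈) X⊆∁S X-closed =
    X-nonempty , X⊆∁S , (λ _ _ u∈X u⇝v → walk-closed X-closed u⇝v u∈X) ,
    (v , x∉p⇒x∈∁p (proj₁ (x∈opposite⁻ v∈)) , proj₂ (x∈opposite⁻ v∈))

  opposite-fragment : Fragment G S X → Fragment G S (opposite S X)
  opposite-fragment {S = S} {X} X-fragment@((u , u∈X) , X⊆∁S , _ , _) =
    closed⇒fragment (fragment⇒opposite-nonempty X-fragment)
      (u , ⊆opposite-opposite X⊆∁S u∈X)
      (λ x∈ → x∉p⇒x∈∁p (proj₁ (x∈opposite⁻ x∈)))
      opposite-closed
    where
    opposite-closed : Closed S (opposite S X)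
    opposite-closed x∈ x∼w w∉S = x∈opposite⁺ w∉S λ w∈X →
      proj₂ (x∈opposite⁻ x∈) (fragment⇒closed X-fragment w∈X (∼-sym x∼w) (proj₁ (x∈opposite⁻ x∈)))

  -- The fragment is the component of u in G − S; deciding reachability vertex by vertex needs
  -- excluded middle, hence the double negation.
  separating⇒¬¬fragment : Separating G S → ¬ ¬ ∃ (Fragment G S)
  separating⇒¬¬fragment {S = S} (u , v , u∈∁S , v∈∁S , u↛v) ¬fragment =
    ¬¬-decide-Fin (Walk G (∁ S) u) λ reach? → ¬fragment (component reach? , component-fragment reach?)
    where
    component : (∀ w → Dec (Walk G (∁ S) u w)) → Subset _
    component reach? = tabulate (does ∘ reach?)
    component⁻ : ∀ reach? {w} → w ∈ component reach? → Walk G (∁ S) u w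
    component⁻ reach? {w} w∈ with reach? w | x∈tabulate⁻ {x = w} {f = does ∘ reach?} w∈
    ... | yes u⇝w | _ = u⇝w
    component⁺ : ∀ reach? {w} → Walk G (∁ S) u w → w ∈ component reach?
    component⁺ reach? {w} u⇝w = x∈tabulate⁺ (dec-true (reach? w) u⇝w)
    component-fragment : ∀ reach? → Fragment G S (component reach?)
    component-fragment reach? = closed⇒fragment
      (u , component⁺ reach? (here u∈∁S))
      (v , x∈opposite⁺ (x∈∁p⇒x∉p v∈∁S) (λ v∈ → u↛v (component⁻ reach? v∈)))
      (λ w∈ → walk-end (component⁻ reach? w∈))
      (λ w∈ w∼w′ w′∉S → component⁺ reach? (walk-snoc (component⁻ reach? w∈) w∼w′ (x∉p⇒x∈∁p w′∉S)))

  corner-closed : Closed S P → Closed S₁ Q → Closed (corner S S₁ P Q) (P ∩ Q)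
  corner-closed {S = S} {S₁ = S₁} P-closed Q-closed {u} {w} u∈P∩Q u∼w w∉T
    with x∈p∩q⁻ _ _ u∈P∩Q | w ∈? S | w ∈? S₁
  ... | _ , _     | yes w∈S | yes w∈S₁ = ⊥-elim (w∉T (x∈corner⁺ (inj₂ (inj₁ (w∈S , w∈S₁)))))
  ... | _ , u∈Q   | yes w∈S | no w∉S₁  = ⊥-elim (w∉T (x∈corner⁺ (inj₁ (w∈S , Q-closed u∈Q u∼w w∉S₁))))
  ... | u∈P , _   | no w∉S  | yes w∈S₁ = ⊥-elim (w∉T (x∈corner⁺ (inj₂ (inj₂ (P-closed u∈P u∼w w∉S , w∈S₁)))))
  ... | u∈P , u∈Q | no w∉S  | no w∉S₁  = x∈p∩q⁺ (P-closed u∈P u∼w w∉S , Q-closed u∈Q u∼w w∉S₁)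

  corner-fragment : Fragment G S P → Fragment G S₁ Q → Nonempty (P ∩ Q) →
    Fragment G (corner S S₁ P Q) (P ∩ Q)
  corner-fragment P-fragment@(_ , P⊆∁S , _) Q-fragment@(_ , Q⊆∁S₁ , _) P∩Q-nonempty =
    closed⇒fragment P∩Q-nonempty
      (v , opposite⊆opposite-corner v∈)
      (P∩Q⊆∁corner P⊆∁S Q⊆∁S₁)
      (corner-closed (fragment⇒closed P-fragment) (fragment⇒closed Q-fragment))
    where
    v  = proj₁ (fragment⇒opposite-nonempty P-fragment)
    v∈ = proj₂ (fragment⇒opposite-nonempty P-fragment)

  no-fragment-within-k-set : ∀ {k} → Bipartite G → MinDegree≥ G (k + 1) →
    ∣ Y ∣ ≡ k → Fragment G Y X → X ⊆ Z → ∣ Z ∣ ≡ k → ⊥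
  no-fragment-within-k-set {Y = Y} {X} {Z} {k} bip δ≥k+1 ∣Y∣≡k X-fragment X⊆Z ∣Z∣≡k =
    <⇒≱ (+-mono-< ∣X∣<k+1 ∣Y∣<k+1)
      (closed⇒d+d≤∣X∣+∣Y∣ bip δ≥k+1 (fragment⇒closed X-fragment) (proj₁ X-fragment) ∣Y∣<k+1)
    where
    k<k+1 : k < k + 1
    k<k+1 = m<m+n k (s≤s z≤n)
    ∣Y∣<k+1 : ∣ Y ∣ < k + 1
    ∣Y∣<k+1 = subst (_< k + 1) (sym ∣Y∣≡k) k<k+1
    ∣X∣<k+1 : ∣ X ∣ < k + 1
    ∣X∣<k+1 = ≤-<-trans (p⊆q⇒∣p∣≤∣q∣ X⊆Z) (subst (_< k + 1) (sym ∣Z∣≡k) k<k+1)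

  module _ {k : ℕ} (κ≥k : ∀ T → Separating G T → k ≤ ∣ T ∣) where

    crossing⇒corner-minsep : ∣ S ∣ ≡ k → ∣ S₁ ∣ ≡ k → Fragment G S P → Fragment G S₁ Q →
      Nonempty (P ∩ Q) → Nonempty (opposite S P ∩ opposite S₁ Q) → MinSep G k (corner S S₁ P Q)
    crossing⇒corner-minsep {S = S} {S₁ = S₁} {P = P} {Q = Q}
      ∣S∣≡k ∣S₁∣≡k P-fragment Q-fragment P∩Q-nonempty P̄∩Q̄-nonempty =
      T-separating , ≤-antisym ∣T∣≤k (κ≥k _ T-separating)
      where
      T-separating = fragment⇒separating (corner-fragment P-fragment Q-fragment P∩Q-nonempty)
      T̄-separating = fragment⇒separating
        (corner-fragment (opposite-fragment P-fragment) (opposite-fragment Q-fragment) P̄∩Q̄-nonempty)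
      ∣T∣≤k : ∣ corner S S₁ P Q ∣ ≤ k
      ∣T∣≤k = +-cancelʳ-≤ k _ k (begin
        ∣ corner S S₁ P Q ∣ + k
          ≤⟨ +-mono-≤ ≤-refl (κ≥k _ T̄-separating) ⟩
        ∣ corner S S₁ P Q ∣ + ∣ corner S S₁ (opposite S P) (opposite S₁ Q) ∣
          ≤⟨ ∣corner∣+∣opposite-corner∣≤∣S∣+∣S₁∣ S S₁ P Q ⟩
        ∣ S ∣ + ∣ S₁ ∣
          ≡⟨ cong₂ _+_ ∣S∣≡k ∣S₁∣≡k ⟩
        k + k ∎)
        where open Data.Nat.Properties.≤-Reasoning

    end-opposite-corner-empty : EndTo G k S P → ∣ S₁ ∣ ≡ k → Fragment G S₁ Q →
      Nonempty (P ∩ S₁) → Nonempty (P ∩ Q) → Empty (opposite S P ∩ opposite S₁ Q)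
    end-opposite-corner-empty ((_ , ∣S∣≡k) , P-fragment , P-end) ∣S₁∣≡k Q-fragment@(_ , Q⊆∁S₁ , _)
      (v , v∈P∩S₁) P∩Q-nonempty P̄∩Q̄-nonempty =
      x∈∁p⇒x∉p (Q⊆∁S₁ (proj₂ (x∈p∩q⁻ _ _ (P⊆P∩Q (proj₁ (x∈p∩q⁻ _ _ v∈P∩S₁))))))
        (proj₂ (x∈p∩q⁻ _ _ v∈P∩S₁))
      where
      P⊆P∩Q = P-end _ _
        (crossing⇒corner-minsep ∣S∣≡k ∣S₁∣≡k P-fragment Q-fragment P∩Q-nonempty P̄∩Q̄-nonempty)
        (corner-fragment P-fragment Q-fragment P∩Q-nonempty)
        (p∩q⊆p _ _)

    module _ (bip : Bipartite G) (δ≥k+1 : MinDegree≥ G (k + 1)) where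

      end∩separator-empty : EndTo G k S F → ∣ S₁ ∣ ≡ k → Fragment G S₁ A → Empty (F ∩ S₁)
      end∩separator-empty {S = S} {F = F} {S₁ = S₁} {A = A}
        F-end@((_ , ∣S∣≡k) , F-fragment , _) ∣S₁∣≡k A-fragment@(_ , A⊆∁S₁ , _) F∩S₁≠∅ =
        cases (nonempty? (F ∩ A)) (nonempty? (F ∩ opposite S₁ A))
        where
        B-fragment = opposite-fragment A-fragment
        F̄∩Q̄-empty : Fragment G S₁ Q → Nonempty (F ∩ Q) → Empty (opposite S F ∩ opposite S₁ Q)
        F̄∩Q̄-empty Q-fragment = end-opposite-corner-empty F-end ∣S₁∣≡k Q-fragment F∩S₁≠∅
        A∩F̄⊆F̄∩opposite-B : A ∩ opposite S F ⊆ opposite S F ∩ opposite S₁ (opposite S₁ A)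
        A∩F̄⊆F̄∩opposite-B x∈ =
          x∈p∩q⁺ (proj₂ (x∈p∩q⁻ _ _ x∈) , ⊆opposite-opposite A⊆∁S₁ (proj₁ (x∈p∩q⁻ _ _ x∈)))
        cases : Dec (Nonempty (F ∩ A)) → Dec (Nonempty (F ∩ opposite S₁ A)) → ⊥
        cases (yes F∩A≠∅) (yes F∩B≠∅) =
          no-fragment-within-k-set bip δ≥k+1 ∣S∣≡k (opposite-fragment F-fragment)
            (∩-sides-empty⇒⊆ (F̄∩Q̄-empty A-fragment F∩A≠∅) (F̄∩Q̄-empty B-fragment F∩B≠∅)) ∣S₁∣≡k
        cases (yes F∩A≠∅) (no F∩B=∅) =
          no-fragment-within-k-set bip δ≥k+1 ∣S₁∣≡k B-fragment
            (∩-sides-empty⇒⊆ (Empty-∩-comm F∩B=∅) (Empty-∩-comm (F̄∩Q̄-empty A-fragment F∩A≠∅))) ∣S∣≡k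
        cases (no F∩A=∅) (yes F∩B≠∅) =
          no-fragment-within-k-set bip δ≥k+1 ∣S₁∣≡k A-fragment
            (∩-sides-empty⇒⊆ (Empty-∩-comm F∩A=∅)
              (λ (x , x∈) → F̄∩Q̄-empty B-fragment F∩B≠∅ (x , A∩F̄⊆F̄∩opposite-B x∈))) ∣S∣≡k
        cases (no F∩A=∅) (no F∩B=∅) =
          no-fragment-within-k-set bip δ≥k+1 ∣S∣≡k F-fragment (∩-sides-empty⇒⊆ F∩A=∅ F∩B=∅) ∣S₁∣≡k

lemma2p1 : (k : ℕ) → 1 ≤ k → (n : ℕ) → (G : Graph n) → Bipartite G →
    Connectivity G k → MinDegree≥ G (k + 1) →
    (S F : Subset n) → EndTo G k S F →
    (S₁ : Subset n) → MinSep G k S₁ →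
    ∀ v → v ∈ F → v ∈ S₁ → ⊥
lemma2p1 k _ n G bip conn δ≥k+1 S F F-end S₁ (S₁-separating , ∣S₁∣≡k) v v∈F v∈S₁ =
  separating⇒¬¬fragment G S₁-separating λ (A , A-fragment) →
    end∩separator-empty G κ≥k bip δ≥k+1 F-end ∣S₁∣≡k A-fragment (v , x∈p∩q⁺ (v∈F , v∈S₁))
  where
  κ≥k : ∀ T → Separating G T → k ≤ ∣ T ∣
  κ≥k T T-separating = proj₂ conn T (inj₁ T-separating)
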